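{- Let $n$ be an even positive integer and $p=\frac{\sqrt{n+1}-1}{2}$. If $\vec P_n$ is an alternating path on $n$ vertices, then $\operatorname{th}(\vec P_n)\ge \frac n2+\lceil 2p\rceil$.
   Context: An alternating path on $n$ vertices is an orientation of the path $P_n$ in which every vertex is a source (in-degree $0$) or a sink (out-degree $0$). Zero forcing on a digraph: vertices are blue or white; a blue vertex $u$ with exactly one white out-neighbor $w$ may force $w$ ($u\to w$), turning it blue. A set $\mathcal F$ of forces is a set of forces of $B\subseteq V$ if, starting with exactly $B$ blue, the forces in $\mathcal F$ can be validly performed in some order after which no further force is possible. Put $\mathcal F^{[0]}=B$ and $\mathcal F^{[t+1]}=\mathcal F^{[t]}\cup\{w\notin\mathcal F^{[t]}:(u\to w)\in\mathcal F,\ u\in\mathcal F^{[t]},\ w$ the only out-neighbor of $u$ outside $\mathcal F^{[t]}\}$; $\operatorname{pt}(\Gamma;\mathcal F)$ is the least $t$ with $\mathcal F^{[t]}=V$ ($\infty$ if none); $\operatorname{pt}(\Gamma;B)=\min_{\mathcal F}\operatorname{pt}(\Gamma;\mathcal F)$; $\operatorname{th}(\Gamma)=\min_{B\subseteq V}(|B|+\operatorname{pt}(\Gamma;B))$. -}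

module Defs where

open import Data.Nat using (ℕ; zero; suc; _+_; _≤_)
open import Data.Fin using (Fin; toℕ)
open import Data.Fin.Subset using (Subset; _∈_; _∉_; ⁅_⁆; _∪_; ∣_∣)
open import Data.Bool using (Bool; true; false)
open import Data.Product using (Σ; _×_; _,_; ∃-syntax)
open import Data.Sum using (_⊎_)
open import Data.List using (List; []; _∷_)
open import Data.List.Membership.Propositional using () renaming (_∈_ to _∈ₗ_)
open import Data.List.Relation.Binary.Permutation.Propositional using (_↭_)
open import Relation.Nullary using (¬_)
open import Relation.Binary.PropositionalEquality using (_≡_)

-- A digraph on vertex set Fin n: G u w ≡ true iff there is an arc u → w.
Digraph : ℕ → Set
Digraph n = Fin n → Fin n → Bool

PathEdge : ∀ {n} → Fin n → Fin n → Set
PathEdge i j = suc (toℕ i) ≡ toℕ j ⊎ suc (toℕ j) ≡ toℕ i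

record IsAlternatingPath {n : ℕ} (G : Digraph n) : Set where
  field
    arc⇒edge     : ∀ u w → G u w ≡ true → PathEdge u w
    edge⇒arc     : ∀ u w → PathEdge u w → (G u w ≡ true) ⊎ (G w u ≡ true)
    oneDirection : ∀ u w → G u w ≡ true → G w u ≡ false
    sourceOrSink : ∀ v → (∀ u → G u v ≡ false) ⊎ (∀ w → G v w ≡ false)

-- A force (u , w) means u → w.
Force : ℕ → Set
Force n = Fin n × Fin n

CanForce : ∀ {n} → Digraph n → Subset n → Force n → Set
CanForce G S (u , w) =
  (u ∈ S) × (w ∉ S) × (G u w ≡ true) ×
  (∀ x → G u x ≡ true → x ∉ S → x ≡ w)

data Run {n : ℕ} (G : Digraph n) : Subset n → List (Force n) → Subset n → Set where
  done : ∀ {S} → Run G S [] S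
  step : ∀ {S u w L T} → CanForce G S (u , w) →
         Run G (S ∪ ⁅ w ⁆) L T → Run G S ((u , w) ∷ L) T

Terminal : ∀ {n} → Digraph n → Subset n → Set
Terminal G T = ∀ f → ¬ CanForce G T f

IsForceSetOf : ∀ {n} → Digraph n → Subset n → List (Force n) → Set
IsForceSetOf {n} G B F =
  Σ (List (Force n)) λ L → (L ↭ F) × Σ (Subset n) λ T → Run G B L T × Terminal G T

-- InStage G B F t v  :  v ∈ F^[t].
InStage : ∀ {n} → Digraph n → Subset n → List (Force n) → ℕ → Fin n → Set
InStage G B F zero    v = v ∈ B
InStage G B F (suc t) v =
  InStage G B F t v ⊎
  ((¬ InStage G B F t v) ×
   ∃[ u ] (((u , v) ∈ₗ F) × InStage G B F t u × (G u v ≡ true) ×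
           (∀ x → G u x ≡ true → ¬ InStage G B F t x → x ≡ v)))

Complete : ∀ {n} → Digraph n → Subset n → List (Force n) → ℕ → Set
Complete G B F t = ∀ v → InStage G B F t v

-- c ≤ th(G) = min over B of (|B| + pt(G;B)), pt(G;B) = min over force sets F
-- of B of pt(G;F), pt(G;F) = least t with F^[t] = V (∞ if none).
ThrottlingAtLeast : ∀ {n} → Digraph n → ℕ → Set
ThrottlingAtLeast {n} G c =
  ∀ (B : Subset n) (F : List (Force n)) (t : ℕ) →
  IsForceSetOf G B F → Complete G B F t → c ≤ ∣ B ∣ + t

-- Group the vertices into the k pairs {2j, 2j+1}; every pair is an edge, so it
-- holds exactly one source.  Sources have no in-arcs, so an initial set B that
-- turns everything blue contains all k of them; with S fully blue pairs, |B| ≥ k + S.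
-- A source u forces only once its other out-neighbour w is blue, and w lies
-- two positions from the forced vertex.  By induction on rounds, a vertex blue
-- after t rounds is a source, within distance 2t of a blue sink, or at distance
-- < 2t from an end of the path that is a source (Witnessed).  As n is even, at
-- most one end is a source.  On pairs: each pair is within t of a fully blue
-- pair or among the t pairs next to that end, so k ≤ t + (2t+1)S (covering).
-- Then 2k < (S+t+1)², hence c ≤ S + t and k + c ≤ |B| + t.

module Submission where

open import Defs
open import Data.Nat using (ℕ; zero; suc; _+_; _*_; _∸_; _≤_; _<_; _≤′_; ≤′-refl; ≤′-step; _≤?_; _<?_; z≤n; s≤s; s≤s⁻¹)
open import Data.Nat.Properties
open import Data.Nat.Induction using (<-wellFounded)
open import Data.Nat.Tactic.RingSolver using (solve-∀)
open import Induction.WellFounded using (Acc; acc)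
open import Data.Bool using (Bool; true; false; _∧_; _∨_)
open import Data.Bool.Properties using (∨-zeroʳ) renaming (_≟_ to _≟ᵇ_)
open import Data.Product using (Σ; _×_; _,_; ∃-syntax; swap)
open import Data.Product.Properties using (≡-dec)
open import Data.Sum using (_⊎_; inj₁; inj₂)
import Data.Sum as Sum
open import Data.Empty using (⊥; ⊥-elim)
open import Data.Vec using (_∷_; []; here; there)
open import Data.List using (List)
import Data.List.Membership.DecPropositional as ListMembership
open import Data.Fin using (Fin; toℕ; fromℕ<)
open import Data.Fin.Properties using (toℕ-fromℕ<; toℕ-injective; toℕ<n; any?; all?) renaming (_≟_ to _≟ᶠ_)
open import Data.Fin.Subset using (Subset; _∈_; ∣_∣)
open import Data.Fin.Subset.Properties using (_∈?_)
open import Relation.Nullary using (¬_; yes; no; contradiction)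
open import Relation.Nullary.Decidable using (Dec; _⊎-dec_; _×-dec_; _→-dec_; ¬?; decidable-stable)
open import Relation.Binary.PropositionalEquality

weight : Bool → ℕ
weight true  = 1
weight false = 0

count : (ℕ → Bool) → ℕ → ℕ
count f zero    = 0
count f (suc m) = count f m + weight (f m)

count-mono : ∀ f {l m} → l ≤ m → count f l ≤ count f m
count-mono f l≤m = go (≤⇒≤′ l≤m)
  where
  go : ∀ {l m} → l ≤′ m → count f l ≤ count f m
  go ≤′-refl      = ≤-refl
  go (≤′-step l≤m) = ≤-trans (go l≤m) (m≤m+n _ _)

count-hit : ∀ f {l s m} → l ≤ s → s < m → f s ≡ true → suc (count f l) ≤ count f m
count-hit f {l} {s} {m} l≤s s<m fs = begin
  suc (count f l)            ≤⟨ s≤s (count-mono f l≤s) ⟩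
  suc (count f s)            ≡⟨ +-comm 1 (count f s) ⟩
  count f s + weight true    ≡⟨ cong (λ b → count f s + weight b) (sym fs) ⟩
  count f (suc s)            ≤⟨ count-mono f s<m ⟩
  count f m                  ∎
  where open ≤-Reasoning

count-stable : ∀ f {m m′} → (∀ s → m ≤ s → f s ≡ false) → m ≤ m′ → count f m′ ≡ count f m
count-stable f {m} vanish m≤m′ = go (≤⇒≤′ m≤m′)
  where
  go : ∀ {m′} → m ≤′ m′ → count f m′ ≡ count f m
  go ≤′-refl = refl
  go {suc m′} (≤′-step m≤m′) = begin
    count f m′ + weight (f m′)  ≡⟨ cong (λ b → count f m′ + weight b) (vanish m′ (≤′⇒≤ m≤m′)) ⟩
    count f m′ + 0              ≡⟨ +-identityʳ _ ⟩
    count f m′                  ≡⟨ go m≤m′ ⟩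
    count f m                   ∎
    where open ≡-Reasoning

count-shift : ∀ f m → count f (suc m) ≡ weight (f 0) + count (λ i → f (suc i)) m
count-shift f zero    = +-comm 0 _
count-shift f (suc m) = begin
  count f (suc m) + weight (f (suc m))                          ≡⟨ cong (_+ weight (f (suc m))) (count-shift f m) ⟩
  weight (f 0) + count (λ i → f (suc i)) m + weight (f (suc m)) ≡⟨ +-assoc (weight (f 0)) _ _ ⟩
  weight (f 0) + count (λ i → f (suc i)) (suc m)                ∎
  where open ≡-Reasoning

-- A subset of Fin n as a predicate on positions (false outside 0 … n-1).
bit : ∀ {n} → Subset n → ℕ → Bool
bit []      _       = false
bit (x ∷ p) zero    = x
bit (x ∷ p) (suc i) = bit p i

bit-∈ : ∀ {n} {p : Subset n} {x} → x ∈ p → bit p (toℕ x) ≡ true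
bit-∈ here         = refl
bit-∈ (there x∈p)  = bit-∈ x∈p

bit-outside : ∀ {n} (p : Subset n) i → n ≤ i → bit p i ≡ false
bit-outside []      i       _         = refl
bit-outside (x ∷ p) (suc i) (s≤s n≤i) = bit-outside p i n≤i

size≡count : ∀ {n} (p : Subset n) → ∣ p ∣ ≡ count (bit p) n
size≡count []                    = refl
size≡count {suc n} (true ∷ p)  = trans (cong suc (size≡count p)) (sym (count-shift (bit (true ∷ p)) n))
size≡count {suc n} (false ∷ p) = trans (size≡count p) (sym (count-shift (bit (false ∷ p)) n))

data InPair (j : ℕ) : ℕ → Set where
  first  : InPair j (j + j)
  second : InPair j (suc (j + j))

pair-of : ∀ x → ∃[ j ] InPair j x
pair-of zero = 0 , first
pair-of (suc x) with pair-of x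
... | j , first  = j , second
... | j , second = suc j , subst (InPair (suc j)) (cong suc (+-suc j j)) first

pair-lower : ∀ {j x} → InPair j x → j + j ≤ x
pair-lower first  = ≤-refl
pair-lower second = n≤1+n _

pair-upper : ∀ {j x} → InPair j x → x ≤ suc (j + j)
pair-upper first  = n≤1+n _
pair-upper second = ≤-refl

bothMarked : (ℕ → Bool) → ℕ → Bool
bothMarked h j = h (j + j) ∧ h (suc (j + j))

pair-weight : ∀ x y → x ∨ y ≡ true → suc (weight (x ∧ y)) ≤ weight x + weight y
pair-weight true  true  _ = ≤-refl
pair-weight true  false _ = ≤-refl
pair-weight false true  _ = ≤-refl

pair-hit : ∀ (h : ℕ → Bool) {j x} → InPair j x → h x ≡ true → h (j + j) ∨ h (suc (j + j)) ≡ true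
pair-hit h {j} first  hx = cong (_∨ h (suc (j + j))) hx
pair-hit h {j} second hx = trans (cong (h (j + j) ∨_) hx) (∨-zeroʳ (h (j + j)))

both-marked : ∀ (h : ℕ → Bool) {j} → h (j + j) ≡ true → h (suc (j + j)) ≡ true → bothMarked h j ≡ true
both-marked h h2j h2j+1 = cong₂ _∧_ h2j h2j+1

pair-count : ∀ h k → (∀ j → j < k → h (j + j) ∨ h (suc (j + j)) ≡ true) →
             k + count (bothMarked h) k ≤ count h (k + k)
pair-count h zero    _      = z≤n
pair-count h (suc k) marked = begin
  suc k + (count (bothMarked h) k + weight (x ∧ y))  ≡⟨ regroup k (count (bothMarked h) k) (weight (x ∧ y)) ⟩
  (k + count (bothMarked h) k) + suc (weight (x ∧ y)) ≤⟨ +-mono-≤ (pair-count h k (λ j j<k → marked j (m<n⇒m<1+n j<k)))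
                                                                 (pair-weight x y (marked k ≤-refl)) ⟩
  count h (k + k) + (weight x + weight y)            ≡⟨ sym (+-assoc (count h (k + k)) _ _) ⟩
  count h (suc (suc (k + k)))                        ≡⟨ cong (λ m → count h (suc m)) (sym (+-suc k k)) ⟩
  count h (suc k + suc k)                            ∎
  where
  open ≤-Reasoning
  x y : Bool
  x = h (k + k)
  y = h (suc (k + k))
  regroup : ∀ k c w → suc k + (c + w) ≡ (k + c) + suc w
  regroup = solve-∀

Near : ℕ → ℕ → ℕ → Set
Near d x y = x ≤ y + d × y ≤ x + d

near-refl : ∀ d x → Near d x x
near-refl d x = m≤m+n x d , m≤m+n x d

near-widen : ∀ {d e x y} → d ≤ e → Near d x y → Near e x y
near-widen {x = x} {y} d≤e (x≤ , y≤) = ≤-trans x≤ (+-monoʳ-≤ y d≤e) , ≤-trans y≤ (+-monoʳ-≤ x d≤e)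

near-trans : ∀ {d e x y z} → Near d x y → Near e y z → Near (d + e) x z
near-trans {d} {e} {x} {y} {z} (x≤ , y≤) (y≤′ , z≤) =
  ≤-trans x≤ (≤-trans (+-monoˡ-≤ d y≤′) (≤-reflexive (trans (+-assoc z e d) (cong (z +_) (+-comm e d))))) ,
  ≤-trans z≤ (≤-trans (+-monoˡ-≤ e y≤) (≤-reflexive (+-assoc x d e)))

Covered : (ℕ → Bool) → ℕ → ℕ → Set
Covered f t j = ∃[ s ] f s ≡ true × Near t j s

-- Covering bound: a marked index covers at most 2t+1 indices, so if every
-- j < m is covered or below a, then m ≤ a + (2t+1)·#marks.  Proof by strong
-- induction: the covering mark s of m-1 is not counted for the first m-(2t+1) indices.
covering : ∀ f t a m → (∀ j → j < m → j < a ⊎ Covered f t j) →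
           m ≤ a + suc (t + t) * count f (m + t)
covering f t a m = go m (<-wellFounded m)
  where
  M : ℕ
  M = suc (t + t)
  go : ∀ m → Acc _<_ m → (∀ j → j < m → j < a ⊎ Covered f t j) → m ≤ a + M * count f (m + t)
  go zero    _           _       = z≤n
  go (suc m) (acc below) covered with covered m ≤-refl
  ... | inj₁ m<a = ≤-trans m<a (m≤m+n a _)
  ... | inj₂ (s , fs , m≤s+t , s≤m+t) with suc m ≤? M
  ...   | yes short = begin
          suc m                      ≤⟨ short ⟩
          M                          ≡⟨ sym (*-identityʳ M) ⟩
          M * 1                      ≤⟨ *-monoʳ-≤ M (count-hit f z≤n (s≤s s≤m+t) fs) ⟩
          M * count f (suc m + t)    ≤⟨ m≤n+m _ a ⟩
          a + M * count f (suc m + t) ∎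
    where open ≤-Reasoning
  ...   | no long = begin
          suc m                                ≡⟨ sym (m∸n+n≡m M≤1+m) ⟩
          r + M                                ≤⟨ +-monoˡ-≤ M (go r (below r<1+m) covered′) ⟩
          a + M * count f (r + t) + M          ≡⟨ add-block a M (count f (r + t)) ⟩
          a + M * suc (count f (r + t))        ≤⟨ +-monoʳ-≤ a (*-monoʳ-≤ M (count-hit f r+t≤s (s≤s s≤m+t) fs)) ⟩
          a + M * count f (suc m + t)          ∎
    where
    open ≤-Reasoning
    M≤1+m : M ≤ suc m
    M≤1+m = <⇒≤ (≰⇒> long)
    r : ℕ
    r = suc m ∸ M
    r<1+m : r < suc m
    r<1+m = s≤s (m∸n≤m m (t + t))
    m≡r+t+t : m ≡ r + t + t
    m≡r+t+t = suc-injective (begin-equality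
      suc m          ≡⟨ sym (m∸n+n≡m M≤1+m) ⟩
      r + M          ≡⟨ +-suc r (t + t) ⟩
      suc (r + (t + t)) ≡⟨ cong suc (sym (+-assoc r t t)) ⟩
      suc (r + t + t) ∎)
    r+t≤s : r + t ≤ s
    r+t≤s = +-cancelʳ-≤ t (r + t) s (subst (_≤ s + t) m≡r+t+t m≤s+t)
    covered′ : ∀ j → j < r → j < a ⊎ Covered f t j
    covered′ j j<r = covered j (<-trans j<r r<1+m)
    add-block : ∀ a M c → a + M * c + M ≡ a + M * suc c
    add-block = solve-∀

-- Two-sided covering: indices j with m ≤ j + b are excused as well; apply
-- the one-sided bound to the first m - b indices.
two-sided-covering : ∀ f t a b m → (∀ j → j < m → j < a ⊎ m ≤ j + b ⊎ Covered f t j) →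
                     m ≤ a + b + suc (t + t) * count f (m + t)
two-sided-covering f t a b m covered = begin
  m                                  ≤⟨ m≤n+m∸n m b ⟩
  b + (m ∸ b)                        ≤⟨ +-monoʳ-≤ b (covering f t a (m ∸ b) covered′) ⟩
  b + (a + M * count f (m ∸ b + t))  ≤⟨ +-monoʳ-≤ b (+-monoʳ-≤ a (*-monoʳ-≤ M
                                          (count-mono f (+-monoˡ-≤ t (m∸n≤m m b))))) ⟩
  b + (a + M * count f (m + t))      ≡⟨ regroup b a (M * count f (m + t)) ⟩
  a + b + M * count f (m + t)        ∎
  where
  open ≤-Reasoning
  M : ℕ
  M = suc (t + t)
  covered′ : ∀ j → j < m ∸ b → j < a ⊎ Covered f t j
  covered′ j j<m∸b with covered j (<-≤-trans j<m∸b (m∸n≤m m b))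
  ... | inj₁ j<a          = inj₁ j<a
  ... | inj₂ (inj₂ cov)   = inj₂ cov
  ... | inj₂ (inj₁ m≤j+b) =
    contradiction (m≤n+o⇒m∸n≤o m b (subst (m ≤_) (+-comm j b) m≤j+b)) (<⇒≱ j<m∸b)
  regroup : ∀ b a c → b + (a + c) ≡ a + b + c
  regroup = solve-∀

-- For x ≤ y, writing y = x + d gives x² + y² = 2xy + d² ≥ 2xy.
twice-product≤squares-ordered : ∀ {x y} → x ≤ y → 2 * (x * y) ≤ x * x + y * y
twice-product≤squares-ordered {x} {y} x≤y with y ∸ x | m+[n∸m]≡n x≤y
... | d | refl = subst (2 * (x * (x + d)) ≤_) (sym (square-gap x d)) (m≤m+n _ (d * d))
  where
  square-gap : ∀ x d → x * x + (x + d) * (x + d) ≡ 2 * (x * (x + d)) + d * d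
  square-gap = solve-∀

twice-product≤squares : ∀ x y → 2 * (x * y) ≤ x * x + y * y
twice-product≤squares x y with ≤-total x y
... | inj₁ x≤y = twice-product≤squares-ordered x≤y
... | inj₂ y≤x = subst₂ _≤_ (cong (2 *_) (*-comm y x)) (+-comm (y * y) (x * x))
                         (twice-product≤squares-ordered y≤x)

square-bound : ∀ k s t → k ≤ t + suc (t + t) * s → 2 * k < suc (s + t) * suc (s + t)
square-bound k s t k≤ = begin-strict
  2 * k                                               ≤⟨ *-monoʳ-≤ 2 k≤ ⟩
  2 * (t + suc (t + t) * s)                           ≡⟨ expand-bound s t ⟩
  2 * (s * t) + (2 * (s * t) + 2 * s + 2 * t)         ≤⟨ +-monoˡ-≤ _ (twice-product≤squares s t) ⟩
  s * s + t * t + (2 * (s * t) + 2 * s + 2 * t)       <⟨ n<1+n _ ⟩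
  suc (s * s + t * t + (2 * (s * t) + 2 * s + 2 * t)) ≡⟨ expand-square s t ⟩
  suc (s + t) * suc (s + t)                           ∎
  where
  open ≤-Reasoning
  expand-bound : ∀ s t → 2 * (t + suc (t + t) * s) ≡ 2 * (s * t) + (2 * (s * t) + 2 * s + 2 * t)
  expand-bound = solve-∀
  expand-square : ∀ s t → suc (s * s + t * t + (2 * (s * t) + 2 * s + 2 * t)) ≡ suc (s + t) * suc (s + t)
  expand-square = solve-∀

double-cancel-< : ∀ {q r} → q + q < r + r → q < r
double-cancel-< {q} {r} q+q<r+r with q <? r
... | yes q<r = q<r
... | no  q≮r = contradiction (+-mono-≤ (≮⇒≥ q≮r) (≮⇒≥ q≮r)) (<⇒≱ q+q<r+r)

half-≤ : ∀ {q r} → q + q ≤ suc (r + r) → q ≤ r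
half-≤ {q} {r} q+q≤ = s≤s⁻¹ (double-cancel-< (s≤s (≤-trans q+q≤ (≤-reflexive (sym (+-suc r r))))))

-- Each round adds 2 to a doubled distance bound.
double-suc : ∀ t → suc t + suc t ≡ 2 + (t + t)
double-suc t = cong suc (+-suc t t)

double-grows : ∀ t → t + t ≤ suc t + suc t
double-grows t = ≤-trans (m≤n+m (t + t) 2) (≤-reflexive (sym (double-suc t)))

pair-shift : ∀ t {q y} → InPair q y → y + (t + t) ≤ suc ((q + t) + (q + t))
pair-shift t {q} {y} q∋y = begin
  y + (t + t)              ≤⟨ +-monoˡ-≤ (t + t) (pair-upper q∋y) ⟩
  suc (q + q) + (t + t)    ≡⟨ cong suc (interchange q t) ⟩
  suc ((q + t) + (q + t))  ∎
  where
  open ≤-Reasoning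
  interchange : ∀ q t → q + q + (t + t) ≡ (q + t) + (q + t)
  interchange = solve-∀

near-pairs : ∀ t {j q x y} → InPair j x → InPair q y → Near (t + t) x y → Near t j q
near-pairs t j∋x q∋y (x≤ , y≤) =
  half-≤ (≤-trans (pair-lower j∋x) (≤-trans x≤ (pair-shift t q∋y))) ,
  half-≤ (≤-trans (pair-lower q∋y) (≤-trans y≤ (pair-shift t j∋x)))

vertex-at : ∀ {n} i → i < n → ∃[ v ] toℕ {n} v ≡ i
vertex-at i i<n = fromℕ< i<n , toℕ-fromℕ< i<n

vertex-below : ∀ {n} (v : Fin n) {i} → i < toℕ v → ∃[ u ] toℕ {n} u ≡ i
vertex-below v i<v = vertex-at _ (<-trans i<v (toℕ<n v))

consecutive : ∀ {n} {u w : Fin n} {i} → toℕ u ≡ i → toℕ w ≡ suc i → PathEdge u w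
consecutive u≡i w≡1+i = inj₁ (trans (cong suc u≡i) (sym w≡1+i))

arc-conflict : ∀ {b : Bool} → b ≡ true → b ≡ false → ⊥
arc-conflict refl ()

two-apart : ∀ {x y m} → x ≡ suc (suc m) → y ≡ m → x ≢ y × Near 2 x y
two-apart {m = m} refl refl = (λ ()) , ≤-reflexive (+-comm 2 m) , ≤-trans (m≤n+m m 2) (m≤m+n (2 + m) 2)

module AlternatingPath {n : ℕ} (G : Digraph n) (AP : IsAlternatingPath G) where
  open IsAlternatingPath AP

  Source : Fin n → Set
  Source v = ∀ u → G u v ≡ false

  Sink : Fin n → Set
  Sink v = ∀ w → G v w ≡ false

  tail-source : ∀ {u w} → G u w ≡ true → Source u
  tail-source {u} {w} g with sourceOrSink u
  ... | inj₁ source = source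
  ... | inj₂ sink   = ⊥-elim (arc-conflict g (sink w))

  head-not-source : ∀ {u w} → G u w ≡ true → ¬ Source w
  head-not-source {u} g source = arc-conflict g (source u)

  arc-from-source : ∀ {u w} → Source u → PathEdge u w → G u w ≡ true
  arc-from-source {u} {w} source e with edge⇒arc u w e
  ... | inj₁ g = g
  ... | inj₂ g = ⊥-elim (arc-conflict g (source w))

  arc-into-sink : ∀ {u w} → Sink w → PathEdge u w → G u w ≡ true
  arc-into-sink {u} {w} sink e with edge⇒arc u w e
  ... | inj₁ g = g
  ... | inj₂ g = ⊥-elim (arc-conflict g (sink u))

  source-or-source : ∀ {u w} → PathEdge u w → Source u × ¬ Source w ⊎ Source w × ¬ Source u
  source-or-source {u} {w} e with edge⇒arc u w e
  ... | inj₁ g = inj₁ (tail-source g , head-not-source g)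
  ... | inj₂ g = inj₂ (tail-source g , head-not-source g)

  LeftSource RightSource : Set
  LeftSource  = ∃[ v ] toℕ v ≡ 0 × Source v
  RightSource = ∃[ v ] suc (toℕ v) ≡ n × Source v

  after-source : ∀ {u w} → PathEdge u w → Source u → ¬ Source w
  after-source e source-u with source-or-source e
  ... | inj₁ (_ , not-w)        = not-w
  ... | inj₂ (_ , not-u)        = ⊥-elim (not-u source-u)

  after-non-source : ∀ {u w} → PathEdge u w → ¬ Source u → Source w
  after-non-source e not-u with source-or-source e
  ... | inj₁ (source-u , _)     = ⊥-elim (not-u source-u)
  ... | inj₂ (source-w , _)     = source-w

  even-sources : LeftSource → ∀ j (v : Fin n) → toℕ v ≡ j + j → Source v
  even-sources (v₀ , v₀≡0 , source₀) zero v v≡0 =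
    subst Source (toℕ-injective (trans v₀≡0 (sym v≡0))) source₀
  even-sources left (suc j) v v≡ =
    let (u , u≡) = vertex-below v (≤-reflexive (sym v≡2+2j))
        (w , w≡) = vertex-below v (≤-trans (n≤1+n _) (≤-reflexive (sym v≡2+2j)))
    in after-non-source (consecutive u≡ v≡2+2j)
         (after-source (consecutive w≡ u≡) (even-sources left j w w≡))
    where
    v≡2+2j : toℕ v ≡ suc (suc (j + j))
    v≡2+2j = trans v≡ (cong suc (+-suc j j))

  -- With an even number 2k ≥ 2 of vertices the two end vertices are not both
  -- sources, as the last one sits at the odd position 2k-1.
  ends-not-both-sources : ∀ k → 1 ≤ k → n ≡ k + k → LeftSource → RightSource → ⊥
  ends-not-both-sources (suc k) _ n≡ left (r , r≡ , source-r) =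
    let (w , w≡) = vertex-below r (≤-reflexive (sym r≡1+2k))
    in after-source (consecutive w≡ r≡1+2k) (even-sources left k w w≡) source-r
    where
    r≡1+2k : toℕ r ≡ suc (k + k)
    r≡1+2k = suc-injective (trans r≡ (trans n≡ (cong suc (+-suc k k))))

  data OtherSide (u v : Fin n) : Set where
    left-end  : toℕ u ≡ 0 → toℕ v ≡ 1 → OtherSide u v
    right-end : suc (toℕ u) ≡ n → suc (toℕ v) ≡ toℕ u → OtherSide u v
    beyond    : ∀ w → G u w ≡ true → toℕ v ≢ toℕ w → Near 2 (toℕ v) (toℕ w) → OtherSide u v

  other-side : ∀ {u v} → G u v ≡ true → OtherSide u v
  other-side {u} {v} g with arc⇒edge u v g
  ... | inj₁ u+1≡v = ascending (toℕ u) refl (sym u+1≡v)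
    where
    ascending : ∀ i → toℕ u ≡ i → toℕ v ≡ suc i → OtherSide u v
    ascending zero    u≡0 v≡1 = left-end u≡0 v≡1
    ascending (suc m) u≡ v≡ =
      let (w , w≡) = vertex-below u (≤-reflexive (sym u≡))
          (v≢w , near) = two-apart v≡ w≡
      in beyond w (arc-from-source (tail-source g) (inj₂ (trans (cong suc w≡) (sym u≡)))) v≢w near
  ... | inj₂ v+1≡u with suc (toℕ u) <? n
  ...   | yes u+1<n =
          let (w , w≡) = vertex-at _ u+1<n
              (w≢v , near) = two-apart (trans w≡ (cong suc (sym v+1≡u))) refl
          in beyond w (arc-from-source (tail-source g) (consecutive refl w≡)) (≢-sym w≢v) (swap near)
  ...   | no  u+1≮n = right-end (≤-antisym (toℕ<n u) (≮⇒≥ u+1≮n)) v+1≡u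

  module Forcing (B : Subset n) (F : List (Force n)) where

    Stage : ℕ → Fin n → Set
    Stage = InStage G B F

    open ListMembership (≡-dec (_≟ᶠ_ {n}) (_≟ᶠ_ {n})) using () renaming (_∈?_ to _∈ᶠ?_)

    -- Membership in F^[t] is decidable, as every quantifier in it ranges over
    -- Fin n or the list F.
    stage? : ∀ t v → Dec (Stage t v)
    stage? zero    v = v ∈? B
    stage? (suc t) v =
      stage? t v ⊎-dec
      (¬? (stage? t v) ×-dec
       any? λ u → ((u , v) ∈ᶠ? F) ×-dec stage? t u ×-dec (G u v ≟ᵇ true) ×-dec
                  all? λ x → (G u x ≟ᵇ true) →-dec ¬? (stage? t x) →-dec (x ≟ᶠ v))

    -- A source has no in-arc, so it is never forced: if blue at all, it was blue initially.
    source-stage : ∀ {t v} → Source v → Stage t v → v ∈ B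
    source-stage {zero}  _      v∈B                               = v∈B
    source-stage {suc t} source (inj₁ earlier)                    = source-stage source earlier
    source-stage {suc t} source (inj₂ (_ , u , _ , _ , g , _))    = ⊥-elim (arc-conflict g (source u))

    data Witnessed (t : ℕ) (v : Fin n) : Set where
      source    : Source v → Witnessed t v
      blue-sink : ∀ b → b ∈ B → Sink b → Near (t + t) (toℕ v) (toℕ b) → Witnessed t v
      left-end  : LeftSource → suc (toℕ v) ≤ t + t → Witnessed t v
      right-end : RightSource → n ≤ toℕ v + (t + t) → Witnessed t v

    witnessed-later : ∀ {t v} → Witnessed t v → Witnessed (suc t) v
    witnessed-later     (source s)                  = source s
    witnessed-later {t} (blue-sink b b∈B sink near) = blue-sink b b∈B sink (near-widen (double-grows t) near)
    witnessed-later {t} (left-end l v<)             = left-end l (≤-trans v< (double-grows t))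
    witnessed-later {t} {v} (right-end r n≤)        = right-end r (≤-trans n≤ (+-monoʳ-≤ (toℕ v) (double-grows t)))

    witnessed-beside : ∀ {t v w} → Near 2 (toℕ v) (toℕ w) → ¬ Source w → Witnessed t w → Witnessed (suc t) v
    witnessed-beside near not-source (source s) = ⊥-elim (not-source s)
    witnessed-beside {t} near _ (blue-sink b b∈B sink near′) =
      blue-sink b b∈B sink (near-widen (≤-reflexive (sym (double-suc t))) (near-trans near near′))
    witnessed-beside {t} {v} {w} (v≤w+2 , _) _ (left-end l w<) = left-end l (begin
      suc (toℕ v)        ≤⟨ s≤s v≤w+2 ⟩
      suc (toℕ w) + 2    ≡⟨ +-comm (suc (toℕ w)) 2 ⟩
      2 + suc (toℕ w)    ≤⟨ +-monoʳ-≤ 2 w< ⟩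
      2 + (t + t)        ≡⟨ sym (double-suc t) ⟩
      suc t + suc t      ∎)
      where open ≤-Reasoning
    witnessed-beside {t} {v} {w} (_ , w≤v+2) _ (right-end r n≤) = right-end r (begin
      n                        ≤⟨ n≤ ⟩
      toℕ w + (t + t)          ≤⟨ +-monoˡ-≤ (t + t) w≤v+2 ⟩
      toℕ v + 2 + (t + t)      ≡⟨ +-assoc (toℕ v) 2 (t + t) ⟩
      toℕ v + (2 + (t + t))    ≡⟨ cong (toℕ v +_) (sym (double-suc t)) ⟩
      toℕ v + (suc t + suc t)  ∎)
      where open ≤-Reasoning

    -- One round of forcing preserves the invariant: the forcing vertex u is a
    -- source; either it is an end vertex next to v, or its other out-neighbour
    -- w was already blue (else u could not force), and w is a witnessed non-source.
    witnessed-forced : ∀ {t u v} → G u v ≡ true → (∀ x → G u x ≡ true → ¬ Stage t x → x ≡ v) →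
                       (∀ x → Stage t x → Witnessed t x) → Witnessed (suc t) v
    witnessed-forced {t} {u} {v} g only earlier with other-side g
    ... | left-end u≡0 v≡1 = left-end (u , u≡0 , tail-source g) (begin
      suc (toℕ v)     ≡⟨ cong suc v≡1 ⟩
      2               ≤⟨ m≤m+n 2 (t + t) ⟩
      2 + (t + t)     ≡⟨ sym (double-suc t) ⟩
      suc t + suc t   ∎)
      where open ≤-Reasoning
    ... | right-end u+1≡n v+1≡u = right-end (u , u+1≡n , tail-source g) (begin
      n                         ≡⟨ trans (sym u+1≡n) (cong suc (sym v+1≡u)) ⟩
      suc (suc (toℕ v))         ≡⟨ +-comm 2 (toℕ v) ⟩
      toℕ v + 2                 ≤⟨ +-monoʳ-≤ (toℕ v) (m≤m+n 2 (t + t)) ⟩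
      toℕ v + (2 + (t + t))     ≡⟨ cong (toℕ v +_) (sym (double-suc t)) ⟩
      toℕ v + (suc t + suc t)   ∎)
      where open ≤-Reasoning
    ... | beyond w gw v≢w near =
          witnessed-beside near (head-not-source gw) (earlier w w-blue)
      where
      w-blue : Stage t w
      w-blue = decidable-stable (stage? t w) (λ w-white → v≢w (cong toℕ (sym (only w gw w-white))))

    witnessed : ∀ t v → Stage t v → Witnessed t v
    witnessed zero v v∈B with sourceOrSink v
    ... | inj₁ src  = source src
    ... | inj₂ sink = blue-sink v v∈B sink (near-refl 0 (toℕ v))
    witnessed (suc t) v (inj₁ earlier)                    = witnessed-later (witnessed t v earlier)
    witnessed (suc t) v (inj₂ (_ , u , _ , _ , g , only)) = witnessed-forced g only (witnessed t)

    module AllBlue (k : ℕ) (1≤k : 1 ≤ k) (n≡2k : n ≡ k + k) (t : ℕ) (complete : ∀ v → Stage t v) where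

      blue : ℕ → Bool
      blue = bit B

      fully-blue : ℕ → Bool
      fully-blue = bothMarked blue

      source-blue : ∀ {v} → Source v → blue (toℕ v) ≡ true
      source-blue src = bit-∈ (source-stage src (complete _))

      pair-in-range : ∀ {j} → j < k → suc (j + j) < n
      pair-in-range {j} j<k = subst (suc (j + j) <_) (sym n≡2k)
        (≤-trans (≤-reflexive (cong suc (sym (+-suc j j)))) (+-mono-≤ j<k j<k))

      pair-index<k : ∀ {j x} → InPair j x → x < n → j < k
      pair-index<k j∋x x<n = double-cancel-< (≤-trans (s≤s (pair-lower j∋x)) (subst (_ <_) n≡2k x<n))

      pair-split : ∀ {j} → j < k → Σ (Fin n) λ s → Σ (Fin n) λ v →
                   Source s × ¬ Source v × InPair j (toℕ s) × InPair j (toℕ v)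
      pair-split {j} j<k =
        let (x , x≡) = vertex-at (j + j) (<-trans (n<1+n (j + j)) (pair-in-range j<k))
            (y , y≡) = vertex-at (suc (j + j)) (pair-in-range j<k)
            x∈j = subst (InPair j) (sym x≡) first
            y∈j = subst (InPair j) (sym y≡) second
        in Sum.[ (λ (source-x , not-y) → x , y , source-x , not-y , x∈j , y∈j)
               , (λ (source-y , not-x) → y , x , source-y , not-x , y∈j , x∈j)
               ]′ (source-or-source (consecutive x≡ y≡))

      pair-has-blue : ∀ j → j < k → blue (j + j) ∨ blue (suc (j + j)) ≡ true
      pair-has-blue j j<k =
        let (s , _ , source-s , _ , s∈j , _) = pair-split j<k
        in pair-hit blue s∈j (source-blue source-s)

      blue-at : ∀ {x i} → x ∈ B → toℕ x ≡ i → blue i ≡ true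
      blue-at x∈B refl = bit-∈ x∈B

      source-at : ∀ {x i} → Source x → toℕ x ≡ i → blue i ≡ true
      source-at source-x refl = source-blue source-x

      -- The pair of an initially blue sink is fully blue: its partner is
      -- adjacent to the sink, hence the tail of an arc, hence a source.
      blue-sink-pair : ∀ {q x} b → b ∈ B → Sink b → toℕ b ≡ x → InPair q x → fully-blue q ≡ true
      blue-sink-pair {q} b b∈B sink b≡ first =
        let q<k      = pair-index<k (first {q}) (subst (_< n) b≡ (toℕ<n b))
            (p , p≡) = vertex-at (suc (q + q)) (pair-in-range q<k)
            source-p = tail-source (arc-into-sink sink (Sum.swap (consecutive b≡ p≡)))
        in both-marked blue {q} (blue-at b∈B b≡) (source-at source-p p≡)
      blue-sink-pair {q} b b∈B sink b≡ second =
        let (p , p≡) = vertex-below b (≤-reflexive (sym b≡))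
            source-p = tail-source (arc-into-sink sink (consecutive p≡ b≡))
        in both-marked blue {q} (source-at source-p p≡) (blue-at b∈B b≡)

      -- The non-source vertex of a pair j < k is witnessed; read on pairs, this
      -- puts pair j within distance t of a fully blue pair, or near a source end.
      pair-covered : ∀ j → j < k →
                     (LeftSource × j < t) ⊎ (RightSource × k ≤ j + t) ⊎ Covered fully-blue t j
      pair-covered j j<k =
        let (_ , v , _ , not-source , _ , v∈j) = pair-split j<k
        in classify v∈j not-source (witnessed t v (complete v))
        where
        classify : ∀ {v} → InPair j (toℕ v) → ¬ Source v → Witnessed t v →
                   (LeftSource × j < t) ⊎ (RightSource × k ≤ j + t) ⊎ Covered fully-blue t j
        classify _ not-source (source src) = ⊥-elim (not-source src)
        classify v∈j _ (blue-sink b b∈B sink near) =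
          let (q , b∈q) = pair-of (toℕ b)
          in inj₂ (inj₂ (q , blue-sink-pair b b∈B sink refl b∈q , near-pairs t v∈j b∈q near))
        classify v∈j _ (left-end left v<) =
          inj₁ (left , double-cancel-< (≤-trans (s≤s (pair-lower v∈j)) v<))
        classify {v} v∈j _ (right-end right n≤) = inj₂ (inj₁ (right , half-≤ (begin
          k + k                    ≡⟨ sym n≡2k ⟩
          n                        ≤⟨ n≤ ⟩
          toℕ v + (t + t)          ≤⟨ pair-shift t v∈j ⟩
          suc ((j + t) + (j + t))  ∎)))
          where open ≤-Reasoning

      fully-blue-vanishes : ∀ s → k ≤ s → fully-blue s ≡ false
      fully-blue-vanishes s k≤s = cong (_∧ blue (suc (s + s)))
        (bit-outside B (s + s) (subst (_≤ s + s) (sym n≡2k) (+-mono-≤ k≤s k≤s)))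

      left-source? : Dec LeftSource
      left-source? = any? λ v → (toℕ v ≟ 0) ×-dec all? (λ u → G u v ≟ᵇ false)

      -- The central estimate k ≤ t + (2t+1)·#(fully blue pairs): at most one end
      -- of the path is a source, the t pairs next to it are excused and every
      -- other pair is covered by a fully blue pair.
      coverage : k ≤ t + suc (t + t) * count fully-blue k
      coverage = subst (λ c → k ≤ t + suc (t + t) * c)
                       (count-stable fully-blue fully-blue-vanishes (m≤m+n k t)) bound
        where
        bound : k ≤ t + suc (t + t) * count fully-blue (k + t)
        bound with left-source?
        ... | yes left = subst (λ a → k ≤ a + suc (t + t) * count fully-blue (k + t)) (+-identityʳ t)
                           (two-sided-covering fully-blue t t 0 k excuse)
          where
          excuse : ∀ j → j < k → j < t ⊎ k ≤ j + 0 ⊎ Covered fully-blue t j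
          excuse j j<k with pair-covered j j<k
          ... | inj₁ (_ , j<t)          = inj₁ j<t
          ... | inj₂ (inj₁ (right , _)) = ⊥-elim (ends-not-both-sources k 1≤k n≡2k left right)
          ... | inj₂ (inj₂ covered)     = inj₂ (inj₂ covered)
        ... | no not-left = two-sided-covering fully-blue t 0 t k excuse
          where
          excuse : ∀ j → j < k → j < 0 ⊎ k ≤ j + t ⊎ Covered fully-blue t j
          excuse j j<k with pair-covered j j<k
          ... | inj₁ (left , _)          = ⊥-elim (not-left left)
          ... | inj₂ (inj₁ (_ , k≤j+t)) = inj₂ (inj₁ k≤j+t)
          ... | inj₂ (inj₂ covered)     = inj₂ (inj₂ covered)

      -- Each pair holds a blue source, and each fully blue pair one more blue vertex.
      blue-count : k + count fully-blue k ≤ ∣ B ∣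
      blue-count = subst (k + count fully-blue k ≤_)
                         (sym (trans (size≡count B) (cong (count blue) n≡2k)))
                         (pair-count blue k pair-has-blue)

-- Proposition 4.5: for an alternating path on n = 2k vertices and
-- c = ⌈2p⌉ = the least c with 2k < (c+1)², th(P⃗ₙ) ≥ k + c.
proposition4p5 : (k : ℕ) → 1 ≤ k → (G : Digraph (2 * k)) → IsAlternatingPath G →
    (c : ℕ) → 2 * k < suc c * suc c →
    (∀ c′ → 2 * k < suc c′ * suc c′ → c ≤ c′) →
    ThrottlingAtLeast G (k + c)
proposition4p5 k 1≤k G AP c _ c-least B F t _ complete = begin
  k + c        ≤⟨ +-monoʳ-≤ k (c-least (S + t) (square-bound k S t coverage)) ⟩
  k + (S + t)  ≡⟨ sym (+-assoc k S t) ⟩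
  k + S + t    ≤⟨ +-monoˡ-≤ t blue-count ⟩
  ∣ B ∣ + t    ∎
  where
  open ≤-Reasoning
  open AlternatingPath G AP
  open Forcing B F
  open AllBlue k 1≤k (cong (k +_) (+-identityʳ k)) t complete
  S : ℕ
  S = count fully-blue k
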